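{- Let $\mathsf{d}$ be a metric on $[n]$ with all nonzero distances at least $1$, let $\varepsilon>0$, and let $\tilde{\mathsf{d}}(s,t)=(1+\varepsilon)^{\lfloor\log_{1+\varepsilon}\mathsf{d}(s,t)\rfloor}$ for $s\ne t$ (and $\tilde{\mathsf{d}}(s,s)=0$). Let $\alpha\ge 1$. If a directed graph $G$ on $[n]$ is $\alpha$-navigable with respect to $\tilde{\mathsf{d}}$, then it is $\alpha/(1+\varepsilon)$-navigable with respect to $\mathsf{d}$. Moreover, if $H$ is $\alpha$-navigable with respect to $\mathsf{d}$, then it is $\alpha/(1+\varepsilon)$-navigable with respect to $\tilde{\mathsf{d}}$.
   Context: For $a>0$, a directed graph $G=([n],E)$ is $a$-navigable with respect to a distance function $\mathsf{d}$ if for every $s,t$ with $\mathsf{d}(s,t)>0$ there is $u$ with $(s,u)\in E$ and $\mathsf{d}(u,t)<\mathsf{d}(s,t)/a$. -}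

module Defs where

open import Level using (Level; suc; _⊔_)
open import Data.Nat using (ℕ; zero) renaming (suc to sucℕ)
open import Data.Fin using (Fin)
open import Data.Product using (Σ; _×_; ∃; ∃-syntax)
open import Data.Sum using (_⊎_)
open import Relation.Binary.PropositionalEquality using (_≡_)
open import Relation.Nullary using (¬_)

-- An ordered field (the real numbers are the intended model).  The
-- inverse is total; its value at 0# is unspecified and never used.
record OrderedField (c : Level) : Set (suc c) where
  infixl 6 _+_
  infixl 7 _*_
  infix  4 _<_
  field
    Carrier : Set c
    0# 1#   : Carrier
    _+_ _*_ : Carrier → Carrier → Carrier
    -_      : Carrier → Carrier
    _⁻¹     : Carrier → Carrier
    _<_     : Carrier → Carrier → Set c
    +-assoc     : ∀ x y z → (x + y) + z ≡ x + (y + z)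
    +-comm      : ∀ x y → x + y ≡ y + x
    +-identityˡ : ∀ x → 0# + x ≡ x
    -‿inverseˡ  : ∀ x → (- x) + x ≡ 0#
    *-assoc     : ∀ x y z → (x * y) * z ≡ x * (y * z)
    *-comm      : ∀ x y → x * y ≡ y * x
    *-identityˡ : ∀ x → 1# * x ≡ x
    distribˡ    : ∀ x y z → x * (y + z) ≡ x * y + x * z
    0≢1         : ¬ (0# ≡ 1#)
    ⁻¹-inverse  : ∀ x → ¬ (x ≡ 0#) → x * (x ⁻¹) ≡ 1#
    <-irrefl    : ∀ x → ¬ (x < x)
    <-trans     : ∀ {x y z} → x < y → y < z → x < z
    <-trichotomy : ∀ x y → x < y ⊎ x ≡ y ⊎ y < x
    +-mono-<    : ∀ {x y} z → x < y → x + z < y + z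
    *-pos       : ∀ {x y} → 0# < x → 0# < y → 0# < x * y

  infix 4 _≤_
  _≤_ : Carrier → Carrier → Set c
  x ≤ y = x < y ⊎ x ≡ y

  infixl 7 _/_
  _/_ : Carrier → Carrier → Carrier
  x / y = x * (y ⁻¹)

  infixr 8 _^_
  _^_ : Carrier → ℕ → Carrier
  x ^ zero = 1#
  x ^ sucℕ k = x * (x ^ k)

module _ {c : Level} (F : OrderedField c) where
  open OrderedField F

  record IsMetric (n : ℕ) (d : Fin n → Fin n → Carrier) : Set c where
    field
      nonneg   : ∀ s t → 0# ≤ d s t
      zero-iff : ∀ s t → d s t ≡ 0# → s ≡ t
      refl-0   : ∀ s → d s s ≡ 0#
      sym      : ∀ s t → d s t ≡ d t s
      triangle : ∀ s t u → d s u ≤ d s t + d t u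

  -- k = ⌊log_b x⌋ (as a natural number; used only for x ≥ 1, b > 1).
  IsFloorLog : Carrier → Carrier → ℕ → Set c
  IsFloorLog b x k = b ^ k ≤ x × x < b ^ sucℕ k

  IsRounding : (n : ℕ) → Carrier → (Fin n → Fin n → Carrier) → (Fin n → Fin n → Carrier) → Set c
  IsRounding n ε d dt =
    (∀ s → dt s s ≡ 0#) ×
    (∀ s t → ¬ (s ≡ t) →
      Σ ℕ λ k → IsFloorLog (1# + ε) (d s t) k × dt s t ≡ (1# + ε) ^ k)

  Navigable : (n : ℕ) → Carrier → (Fin n → Fin n → Carrier) → (Fin n → Fin n → Set c) → Set c
  Navigable n a d E =
    ∀ s t → 0# < d s t → ∃[ u ] (E s u × d u t < d s t / a)

{-# OPTIONS --safe #-}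
-- Rounding down to a power of b = 1 + ε changes a distance by less than a
-- factor b: d~ ≤ d ≤ b d~.  Navigability is invariant under scaling the
-- distance, and whenever T ≤ S ≤ b T, a step that shrinks S by a factor α
-- shrinks T by a factor α/b.  The two claims are this comparison for
-- (T , S) = (d , b d~) and (d~ , d).
module Submission where

open import Defs
open import Level using (Level)
open import Data.Nat using (ℕ)
open import Data.Fin using (Fin; _≟_)
open import Data.Product using (_×_; _,_)
open import Data.Sum using (inj₁; inj₂)
open import Data.Empty using (⊥-elim)
open import Relation.Binary.Bundles using (StrictPartialOrder)
open import Relation.Binary.Structures using (IsStrictPartialOrder)
import Relation.Binary.Reasoning.StrictPartialOrder as StrictReasoning
open import Relation.Binary.PropositionalEquality
  using (_≡_; refl; sym; trans; cong; subst; resp₂; isEquivalence; module ≡-Reasoning)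
open import Relation.Nullary using (¬_; yes; no)

module OrderedFieldProperties {c : Level} (F : OrderedField c) where
  open OrderedField F

  <-isStrictPartialOrder : IsStrictPartialOrder _≡_ _<_
  <-isStrictPartialOrder = record
    { isEquivalence = isEquivalence
    ; irrefl        = λ { refl → <-irrefl _ }
    ; trans         = <-trans
    ; <-resp-≈      = resp₂ _<_
    }

  <-strictPartialOrder : StrictPartialOrder c c c
  <-strictPartialOrder = record { isStrictPartialOrder = <-isStrictPartialOrder }

  module ≤-Reasoning = StrictReasoning <-strictPartialOrder

  +-identityʳ : ∀ x → x + 0# ≡ x
  +-identityʳ x = trans (+-comm x 0#) (+-identityˡ x)

  +-inverseʳ : ∀ x → x + (- x) ≡ 0#
  +-inverseʳ x = trans (+-comm x (- x)) (-‿inverseˡ x)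

  *-identityʳ : ∀ x → x * 1# ≡ x
  *-identityʳ x = trans (*-comm x 1#) (*-identityˡ x)

  x+-y+y≡x : ∀ x y → x + (- y) + y ≡ x
  x+-y+y≡x x y = begin
    x + (- y) + y   ≡⟨ +-assoc x (- y) y ⟩
    x + ((- y) + y) ≡⟨ cong (x +_) (-‿inverseˡ y) ⟩
    x + 0#          ≡⟨ +-identityʳ x ⟩
    x               ∎
    where open ≡-Reasoning

  x≡x+x⇒x≡0 : ∀ x → x ≡ x + x → x ≡ 0#
  x≡x+x⇒x≡0 x x≡x+x = begin
    x                ≡⟨ +-identityˡ x ⟨
    0# + x           ≡⟨ cong (_+ x) (-‿inverseˡ x) ⟨
    (- x) + x + x    ≡⟨ +-assoc (- x) x x ⟩
    (- x) + (x + x)  ≡⟨ cong ((- x) +_) x≡x+x ⟨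
    (- x) + x        ≡⟨ -‿inverseˡ x ⟩
    0#               ∎
    where open ≡-Reasoning

  *-zeroʳ : ∀ x → x * 0# ≡ 0#
  *-zeroʳ x = x≡x+x⇒x≡0 (x * 0#)
    (trans (cong (x *_) (sym (+-identityˡ 0#))) (distribˡ x 0# 0#))

  *-monoʳ-<-pos : ∀ z → 0# < z → ∀ {x y} → x < y → z * x < z * y
  *-monoʳ-<-pos z 0<z {x} {y} x<y = begin-strict
    z * x                  ≡⟨ +-identityˡ (z * x) ⟨
    0# + z * x             <⟨ +-mono-< (z * x) (*-pos 0<z 0<y+-x) ⟩
    z * (y + (- x)) + z * x ≡⟨ distribˡ z (y + (- x)) x ⟨
    z * (y + (- x) + x)     ≡⟨ cong (z *_) (x+-y+y≡x y x) ⟩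
    z * y                  ∎
    where
    open ≤-Reasoning
    0<y+-x : 0# < y + (- x)
    0<y+-x = begin-strict
      0#         ≡⟨ +-inverseʳ x ⟨
      x + (- x)  <⟨ +-mono-< (- x) x<y ⟩
      y + (- x)  ∎

  *-monoˡ-<-pos : ∀ z → 0# < z → ∀ {x y} → x < y → x * z < y * z
  *-monoˡ-<-pos z 0<z {x} {y} x<y = begin-strict
    x * z ≡⟨ *-comm x z ⟩
    z * x <⟨ *-monoʳ-<-pos z 0<z x<y ⟩
    z * y ≡⟨ *-comm z y ⟩
    y * z ∎
    where open ≤-Reasoning

  *-monoʳ-≤-pos : ∀ z → 0# < z → ∀ {x y} → x ≤ y → z * x ≤ z * y
  *-monoʳ-≤-pos z 0<z (inj₁ x<y)  = inj₁ (*-monoʳ-<-pos z 0<z x<y)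
  *-monoʳ-≤-pos z 0<z (inj₂ refl) = inj₂ refl

  *-monoˡ-≤-pos : ∀ z → 0# < z → ∀ {x y} → x ≤ y → x * z ≤ y * z
  *-monoˡ-≤-pos z 0<z (inj₁ x<y)  = inj₁ (*-monoˡ-<-pos z 0<z x<y)
  *-monoˡ-≤-pos z 0<z (inj₂ refl) = inj₂ refl

  0<x⇒x≢0 : ∀ {x} → 0# < x → ¬ (x ≡ 0#)
  0<x⇒x≢0 0<x refl = <-irrefl 0# 0<x

  0<z*x⇒0<x : ∀ {z x} → 0# < z → 0# < z * x → 0# < x
  0<z*x⇒0<x {z} {x} 0<z 0<zx with <-trichotomy 0# x
  ... | inj₁ 0<x        = 0<x
  ... | inj₂ (inj₁ refl) = ⊥-elim (0<x⇒x≢0 0<zx (*-zeroʳ z))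
  ... | inj₂ (inj₂ x<0) = ⊥-elim (<-irrefl 0# (begin-strict
    0#     <⟨ 0<zx ⟩
    z * x  <⟨ *-monoʳ-<-pos z 0<z x<0 ⟩
    z * 0# ≡⟨ *-zeroʳ z ⟩
    0#     ∎))
    where open ≤-Reasoning

  0<1 : 0# < 1#
  0<1 with <-trichotomy 0# 1#
  ... | inj₁ 0<1        = 0<1
  ... | inj₂ (inj₁ 0≡1) = ⊥-elim (0≢1 0≡1)
  ... | inj₂ (inj₂ 1<0) = ⊥-elim (<-irrefl 0# (<-trans 0<-1 -1<0))
    where
    open ≤-Reasoning
    0<-1 : 0# < - 1#
    0<-1 = begin-strict
      0#          ≡⟨ +-inverseʳ 1# ⟨
      1# + (- 1#) <⟨ +-mono-< (- 1#) 1<0 ⟩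
      0# + (- 1#) ≡⟨ +-identityˡ (- 1#) ⟩
      - 1#        ∎
    -1<0 : - 1# < 0#
    -1<0 = begin-strict
      - 1#       ≡⟨ *-identityʳ (- 1#) ⟨
      - 1# * 1#  <⟨ *-monoʳ-<-pos (- 1#) 0<-1 1<0 ⟩
      - 1# * 0#  ≡⟨ *-zeroʳ (- 1#) ⟩
      0#         ∎

  ⁻¹-pos : ∀ {x} → 0# < x → 0# < x ⁻¹
  ⁻¹-pos {x} 0<x with <-trichotomy 0# (x ⁻¹)
  ... | inj₁ 0<x⁻¹         = 0<x⁻¹
  ... | inj₂ (inj₁ 0≡x⁻¹) = ⊥-elim (0≢1 (begin
    0#       ≡⟨ *-zeroʳ x ⟨
    x * 0#   ≡⟨ cong (x *_) 0≡x⁻¹ ⟩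
    x * x ⁻¹ ≡⟨ ⁻¹-inverse x (0<x⇒x≢0 0<x) ⟩
    1#       ∎))
    where open ≡-Reasoning
  ... | inj₂ (inj₂ x⁻¹<0) = ⊥-elim (<-irrefl 0# (begin-strict
    0#       <⟨ 0<1 ⟩
    1#       ≡⟨ ⁻¹-inverse x (0<x⇒x≢0 0<x) ⟨
    x * x ⁻¹ <⟨ *-monoʳ-<-pos x 0<x x⁻¹<0 ⟩
    x * 0#   ≡⟨ *-zeroʳ x ⟩
    0#       ∎))
    where open ≤-Reasoning

  x*y/y≡x : ∀ x {y} → ¬ (y ≡ 0#) → x * y / y ≡ x
  x*y/y≡x x {y} y≢0 = begin
    x * y * y ⁻¹   ≡⟨ *-assoc x y (y ⁻¹) ⟩
    x * (y * y ⁻¹) ≡⟨ cong (x *_) (⁻¹-inverse y y≢0) ⟩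
    x * 1#         ≡⟨ *-identityʳ x ⟩
    x              ∎
    where open ≡-Reasoning

  x/y*y≡x : ∀ x {y} → ¬ (y ≡ 0#) → x / y * y ≡ x
  x/y*y≡x x {y} y≢0 = begin
    x * y ⁻¹ * y   ≡⟨ *-assoc x (y ⁻¹) y ⟩
    x * (y ⁻¹ * y) ≡⟨ cong (x *_) (*-comm (y ⁻¹) y) ⟩
    x * (y * y ⁻¹) ≡⟨ cong (x *_) (⁻¹-inverse y y≢0) ⟩
    x * 1#         ≡⟨ *-identityʳ x ⟩
    x              ∎
    where open ≡-Reasoning

  x*z<y⇒x<y/z : ∀ {x y z} → 0# < z → x * z < y → x < y / z
  x*z<y⇒x<y/z {x} {y} {z} 0<z xz<y = begin-strict
    x          ≡⟨ x*y/y≡x x (0<x⇒x≢0 0<z) ⟨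
    x * z / z  <⟨ *-monoˡ-<-pos (z ⁻¹) (⁻¹-pos 0<z) xz<y ⟩
    y / z      ∎
    where open ≤-Reasoning

  x<y/z⇒x*z<y : ∀ {x y z} → 0# < z → x < y / z → x * z < y
  x<y/z⇒x*z<y {x} {y} {z} 0<z x<y/z = begin-strict
    x * z      <⟨ *-monoˡ-<-pos z 0<z x<y/z ⟩
    y / z * z  ≡⟨ x/y*y≡x y (0<x⇒x≢0 0<z) ⟩
    y          ∎
    where open ≤-Reasoning

module NavigabilityProperties {c : Level} (F : OrderedField c) where
  open OrderedField F
  open OrderedFieldProperties F
  open ≤-Reasoning

  navigable-scale : ∀ {n a b} {D : Fin n → Fin n → Carrier}
    {E : Fin n → Fin n → Set c} → 0# < b →
    Navigable F n a D E → Navigable F n a (λ x y → b * D x y) E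
  navigable-scale {a = a} {b} {D} 0<b nav s t 0<bDst
    with nav s t (0<z*x⇒0<x 0<b 0<bDst)
  ... | u , Esu , Dut<Dst/a = u , Esu , (begin-strict
    b * D u t        <⟨ *-monoʳ-<-pos b 0<b Dut<Dst/a ⟩
    b * (D s t / a)  ≡⟨ *-assoc b (D s t) (a ⁻¹) ⟨
    b * D s t / a    ∎)

  navigable-sandwich : ∀ {n a b} {T S : Fin n → Fin n → Carrier}
    {E : Fin n → Fin n → Set c} → 0# < a → 0# < b →
    (∀ x y → T x y ≤ S x y) → (∀ x y → S x y ≤ b * T x y) →
    Navigable F n a S E → Navigable F n (a / b) T E
  navigable-sandwich {a = a} {b} {T} {S} 0<a 0<b T≤S S≤bT nav s t 0<Tst
    with nav s t (begin-strict 0# <⟨ 0<Tst ⟩ T s t ≤⟨ T≤S s t ⟩ S s t ∎)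
  ... | u , Esu , Sut<Sst/a = u , Esu , x*z<y⇒x<y/z 0<a/b (begin-strict
    T u t * (a / b)  ≤⟨ *-monoˡ-≤-pos (a / b) 0<a/b (T≤S u t) ⟩
    S u t * (a / b)  ≡⟨ *-assoc (S u t) a (b ⁻¹) ⟨
    S u t * a / b    <⟨ *-monoˡ-<-pos (b ⁻¹) 0<b⁻¹ (x<y/z⇒x*z<y 0<a Sut<Sst/a) ⟩
    S s t / b        ≤⟨ *-monoˡ-≤-pos (b ⁻¹) 0<b⁻¹ (S≤bT s t) ⟩
    b * T s t / b    ≡⟨ cong (_/ b) (*-comm b (T s t)) ⟩
    T s t * b / b    ≡⟨ x*y/y≡x (T s t) (0<x⇒x≢0 0<b) ⟩
    T s t            ∎)
    where
    0<b⁻¹ : 0# < b ⁻¹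
    0<b⁻¹ = ⁻¹-pos 0<b
    0<a/b : 0# < a / b
    0<a/b = *-pos 0<a 0<b⁻¹

module RoundingProperties {c : Level} (F : OrderedField c) where
  open OrderedField F
  open OrderedFieldProperties F

  module _ {n : ℕ} {ε : Carrier} {d dt : Fin n → Fin n → Carrier}
           (d-refl : ∀ s → d s s ≡ 0#) where

    rounding-≤ : IsRounding F n ε d dt → ∀ s t → dt s t ≤ d s t
    rounding-≤ (dt-refl , dt-pow) s t with s ≟ t
    ... | yes refl = inj₂ (trans (dt-refl s) (sym (d-refl s)))
    ... | no s≢t with dt-pow s t s≢t
    ... | k , (bᵏ≤d , _) , dt≡bᵏ = subst (_≤ d s t) (sym dt≡bᵏ) bᵏ≤d

    ≤-1+ε*rounding : IsRounding F n ε d dt → ∀ s t → d s t ≤ (1# + ε) * dt s t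
    ≤-1+ε*rounding (dt-refl , dt-pow) s t with s ≟ t
    ... | yes refl = inj₂ (begin
      d s s             ≡⟨ d-refl s ⟩
      0#                ≡⟨ *-zeroʳ (1# + ε) ⟨
      (1# + ε) * 0#     ≡⟨ cong ((1# + ε) *_) (dt-refl s) ⟨
      (1# + ε) * dt s s ∎)
      where open ≡-Reasoning
    ... | no s≢t with dt-pow s t s≢t
    ... | k , (_ , d<bᵏ⁺¹) , dt≡bᵏ =
      inj₁ (subst (λ x → d s t < (1# + ε) * x) (sym dt≡bᵏ) d<bᵏ⁺¹)

claim5p13 : {c : Level} (F : OrderedField c) → let open OrderedField F in
    (n : ℕ) (d dt : Fin n → Fin n → Carrier) (ε α : Carrier) →
    IsMetric F n d →
    (∀ s t → ¬ (s ≡ t) → 1# ≤ d s t) →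
    0# < ε →
    IsRounding F n ε d dt →
    1# ≤ α →
    ((G : Fin n → Fin n → Set c) →
      Navigable F n α dt G → Navigable F n (α / (1# + ε)) d G)
    ×
    ((H : Fin n → Fin n → Set c) →
      Navigable F n α d H → Navigable F n (α / (1# + ε)) dt H)
claim5p13 F n d dt ε α metric _ 0<ε rounding 1≤α =
  (λ G nav → navigable-sandwich 0<α 0<b d≤b*dt b*dt≤b*d (navigable-scale 0<b nav)) ,
  (λ H → navigable-sandwich 0<α 0<b dt≤d d≤b*dt)
  where
  open OrderedField F
  open OrderedFieldProperties F
  open NavigabilityProperties F
  open RoundingProperties F
  open IsMetric metric using (refl-0)
  open ≤-Reasoning
  b : Carrier
  b = 1# + ε
  0<b : 0# < b
  0<b = begin-strict
    0#      <⟨ 0<1 ⟩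
    1#      ≡⟨ +-identityˡ 1# ⟨
    0# + 1# <⟨ +-mono-< 1# 0<ε ⟩
    ε + 1#  ≡⟨ +-comm ε 1# ⟩
    b       ∎
  0<α : 0# < α
  0<α = begin-strict 0# <⟨ 0<1 ⟩ 1# ≤⟨ 1≤α ⟩ α ∎
  dt≤d : ∀ s t → dt s t ≤ d s t
  dt≤d = rounding-≤ refl-0 rounding
  d≤b*dt : ∀ s t → d s t ≤ b * dt s t
  d≤b*dt = ≤-1+ε*rounding refl-0 rounding
  b*dt≤b*d : ∀ s t → b * dt s t ≤ b * d s t
  b*dt≤b*d s t = *-monoʳ-≤-pos b 0<b (dt≤d s t)
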